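{- Let $S$ be a Seidel matrix of odd order $n$, and let $\lambda,\mu,\nu$ be integers with $\lambda$ and $\mu$ odd. Then the underlying graph of $S$ is the unique Euler graph contained in the switching class of $S$ if and only if $$(S-\lambda I)(S-\mu I)\equiv_4(n-2-\lambda-\mu)J\quad\text{and}\quad(S-\lambda I)(S-\mu I)(S-\nu I)\equiv_4(n-2-\lambda-\mu)(n-1-\nu)J.$$
   Context: A Seidel matrix is a symmetric matrix with zero diagonal and off-diagonal entries in $\{\pm1\}$. $J$ is the all-ones matrix and $I$ the identity matrix of order $n$. The underlying graph $\Gamma(S)$ of $S$ is the graph with adjacency matrix $(J-I-S)/2$. The switching class of $S$ is the set of graphs $\Gamma(DSD)$ where $D$ ranges over diagonal matrices with diagonal entries in $\{\pm1\}$. An Euler graph is a graph all of whose vertices have even degree; for $n$ odd, the switching class of $S$ contains exactly one Euler graph. For integer matrices $A,B$ of the same size, $A\equiv_4 B$ means every entry of $A-B$ is divisible by $4$. -}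

module Defs where

open import Data.Nat as ℕ using (ℕ)
open import Data.Integer as ℤ using (ℤ; +_; -[1+_]; _+_; _-_; _*_; -_)
open import Data.Integer.Divisibility using (_∣_)
import Data.Nat.Divisibility as ℕᵈ
open import Data.Fin using (Fin; zero; suc)
open import Data.Fin.Properties using (_≟_)
open import Data.Product using (_×_; Σ)
open import Data.Sum using (_⊎_)
open import Relation.Binary.PropositionalEquality using (_≡_; _≢_)
open import Relation.Nullary using (¬_; yes; no)

Mat : ℕ → Set
Mat n = Fin n → Fin n → ℤ

sumFin : ∀ {n} → (Fin n → ℤ) → ℤ
sumFin {ℕ.zero} f = + 0
sumFin {ℕ.suc n} f = f zero + sumFin (λ i → f (suc i))

sumFinℕ : ∀ {n} → (Fin n → ℕ) → ℕ
sumFinℕ {ℕ.zero} f = 0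
sumFinℕ {ℕ.suc n} f = f zero ℕ.+ sumFinℕ (λ i → f (suc i))

infixl 7 _⊗_
_⊗_ : ∀ {n} → Mat n → Mat n → Mat n
(A ⊗ B) i j = sumFin (λ k → A i k * B k j)

infixl 6 _⊖_
_⊖_ : ∀ {n} → Mat n → Mat n → Mat n
(A ⊖ B) i j = A i j - B i j

infixl 7 _·_
_·_ : ∀ {n} → ℤ → Mat n → Mat n
(c · A) i j = c * A i j

I : ∀ {n} → Mat n
I i j with i ≟ j
... | yes _ = + 1
... | no  _ = + 0

J : ∀ {n} → Mat n
J i j = + 1

_≡₄_ : ∀ {n} → Mat n → Mat n → Set
A ≡₄ B = ∀ i j → + 4 ∣ (A i j - B i j)

IsSeidel : ∀ {n} → Mat n → Set
IsSeidel {n} S =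
  (∀ i j → S i j ≡ S j i) ×
  (∀ i → S i i ≡ + 0) ×
  (∀ i j → i ≢ j → (S i j ≡ + 1) ⊎ (S i j ≡ - + 1))

-- Graphs on Fin n given by their (0/1) adjacency matrix
Graph : ℕ → Set
Graph n = Fin n → Fin n → ℕ

-- Underlying graph Γ(S) with adjacency matrix (J - I - S)/2:
-- i ~ j iff i ≠ j and S i j = -1.
Γ : ∀ {n} → Mat n → Graph n
Γ S i j with i ≟ j
... | yes _ = 0
... | no  _ with S i j ℤ.≟ - + 1
...   | yes _ = 1
...   | no  _ = 0

degree : ∀ {n} → Graph n → Fin n → ℕ
degree G i = sumFinℕ (λ j → G i j)

IsEuler : ∀ {n} → Graph n → Set
IsEuler G = ∀ i → 2 ℕᵈ.∣ degree G i

_≅G_ : ∀ {n} → Graph n → Graph n → Set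
G ≅G H = ∀ i j → G i j ≡ H i j

-- Diagonal ±1 matrices, given by their diagonal
IsSignVec : ∀ {n} → (Fin n → ℤ) → Set
IsSignVec d = ∀ i → (d i ≡ + 1) ⊎ (d i ≡ - + 1)

-- DSD for D = diag(d)
switch : ∀ {n} → (Fin n → ℤ) → Mat n → Mat n
switch d S i j = d i * S i j * d j

InSwitchingClass : ∀ {n} → Graph n → Mat n → Set
InSwitchingClass {n} G S = Σ (Fin n → ℤ) λ d → IsSignVec d × (G ≅G Γ (switch d S))

IsUniqueEulerInClass : ∀ {n} → Graph n → Mat n → Set
IsUniqueEulerInClass G S =
  InSwitchingClass G S × IsEuler G ×
  (∀ H → InSwitchingClass H S → IsEuler H → H ≅G G)

-- Write S = J - I - 2A, where A is the adjacency matrix of Γ(S) and degᵢ its degrees. The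
-- argument rests on the rule xy ≡ x + y - 1 (mod 4) for odd x and y. For odd λ every entry of
-- S - λI is odd, so ((S - λI)(S - μI))ᵢⱼ ≡ (row sum i) + (column sum j) - n, and the row sums
-- of S are n - 1 - 2degᵢ. Hence the first congruence says 2(degᵢ + degⱼ) ≡ 0 (mod 4); granting
-- it, the (i, j) entry of the triple product is ≡ c(n - 1 - ν) - 2c·degⱼ with c = n - 2 - λ - μ
-- odd, so the second congruence says that every degree is even.
-- For uniqueness, let d be a sign vector with Γ(S) and Γ(DSD) both Euler. Comparing the row
-- sums of DSD modulo 4, again by the product rule (applied to S + I and d), gives dᵢ·Σd ≡ n
-- for all i. As n is odd so is Σd, which forces all dᵢ to be equal, whence DSD = S.
module Submission where

open import Defs
open import Data.Nat as ℕ using (ℕ)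
open import Data.Integer as ℤ using (ℤ; +_; _-_; _*_)
open import Data.Integer.Divisibility using (_∣_)
import Data.Nat.Divisibility as ℕᵈ
open import Data.Product using (_×_)
open import Relation.Nullary using (¬_)
open import Function.Bundles using (_⇔_)

import Data.Integer.Properties as ℤP
open import Algebra.Properties.CommutativeSemigroup ℤP.+-commutativeSemigroup using (interchange)
open import Data.Empty using (⊥-elim)
open import Data.Fin using (Fin; zero; suc)
open import Data.Fin.Properties using (_≟_)
open import Data.Integer using (_+_; -_; 0ℤ)
open import Data.Integer.Divisibility.Signed as Signed
  using (divides; ∣ᵤ⇒∣; ∣⇒∣ᵤ; ∣m∣n⇒∣m+n; ∣m⇒∣-m; ∣m⇒∣m*n; ∣n⇒∣m*n; *-monoʳ-∣;
         *-cancelˡ-∣)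
open import Data.Integer.DivMod using (_%ℕ_; _/ℕ_; n%ℕd<d; a≡a%ℕn+[a/ℕn]*n)
open import Data.Integer.Tactic.RingSolver using (solve-∀)
open import Data.Product using (_,_; proj₁; proj₂)
open import Data.Sum using (_⊎_; inj₁; inj₂)
open import Function using (_∘_)
open import Function.Bundles using (mk⇔)
open import Level using (0ℓ)
open import Relation.Binary.Bundles using (Setoid)
open import Relation.Binary.Structures using (IsEquivalence)
open import Relation.Binary.PropositionalEquality
  using (_≡_; refl; sym; trans; cong; cong₂; subst; module ≡-Reasoning)
open import Relation.Nullary using (yes; no)

-- Congruences of integers

-- A record rather than an abbreviation for m ∣ a - b, so that Agda can infer a and b, which it
-- cannot recover from the difference a - b.
infix 4 _≡_mod_
record _≡_mod_ (a b m : ℤ) : Set where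
  constructor divides-difference
  field m∣a-b : m Signed.∣ a - b
open _≡_mod_

module _ {m : ℤ} where

  ≡mod-witness : ∀ {a b} q → a - b ≡ q * m → a ≡ b mod m
  ≡mod-witness q eq = divides-difference (divides q eq)

  private
    rearranged : ∀ {a b x} → x ≡ a - b → m Signed.∣ x → a ≡ b mod m
    rearranged x≡a-b m∣x = divides-difference (subst (m Signed.∣_) x≡a-b m∣x)

  ≡mod-refl : ∀ {a} → a ≡ a mod m
  ≡mod-refl {a} = ≡mod-witness 0ℤ (lemma a)
    where
    lemma : ∀ a → a - a ≡ 0ℤ * m
    lemma = solve-∀

  ≡⇒≡mod : ∀ {a b} → a ≡ b → a ≡ b mod m
  ≡⇒≡mod refl = ≡mod-refl

  ≡mod-sym : ∀ {a b} → a ≡ b mod m → b ≡ a mod m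
  ≡mod-sym {a} {b} (divides-difference p) = rearranged (lemma a b) (∣m⇒∣-m p)
    where
    lemma : ∀ a b → - (a - b) ≡ b - a
    lemma = solve-∀

  ≡mod-trans : ∀ {a b c} → a ≡ b mod m → b ≡ c mod m → a ≡ c mod m
  ≡mod-trans {a} {b} {c} (divides-difference p) (divides-difference q) =
    rearranged (lemma a b c) (∣m∣n⇒∣m+n p q)
    where
    lemma : ∀ a b c → (a - b) + (b - c) ≡ a - c
    lemma = solve-∀

  ≡mod-isEquivalence : IsEquivalence (λ a b → a ≡ b mod m)
  ≡mod-isEquivalence = record { refl = ≡mod-refl ; sym = ≡mod-sym ; trans = ≡mod-trans }

  +-cong-mod : ∀ {a b c d} → a ≡ b mod m → c ≡ d mod m → a + c ≡ b + d mod m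
  +-cong-mod {a} {b} {c} {d} (divides-difference p) (divides-difference q) =
    rearranged (lemma a b c d) (∣m∣n⇒∣m+n p q)
    where
    lemma : ∀ a b c d → (a - b) + (c - d) ≡ (a + c) - (b + d)
    lemma = solve-∀

  neg-cong-mod : ∀ {a b} → a ≡ b mod m → - a ≡ - b mod m
  neg-cong-mod {a} {b} (divides-difference p) = rearranged (lemma a b) (∣m⇒∣-m p)
    where
    lemma : ∀ a b → - (a - b) ≡ - a - - b
    lemma = solve-∀

  -‿cong-mod : ∀ {a b c d} → a ≡ b mod m → c ≡ d mod m → a - c ≡ b - d mod m
  -‿cong-mod p q = +-cong-mod p (neg-cong-mod q)

  *-cong-mod : ∀ {a b c d} → a ≡ b mod m → c ≡ d mod m → a * c ≡ b * d mod m
  *-cong-mod {a} {b} {c} {d} (divides-difference p) (divides-difference q) =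
    rearranged (lemma a b c d) (∣m∣n⇒∣m+n (∣m⇒∣m*n c p) (∣n⇒∣m*n b q))
    where
    lemma : ∀ a b c d → (a - b) * c + b * (c - d) ≡ a * c - b * d
    lemma = solve-∀

  x≡0⇒a-x≡a : ∀ {a x} → x ≡ 0ℤ mod m → a - x ≡ a mod m
  x≡0⇒a-x≡a {a} x≡0 =
    ≡mod-trans (-‿cong-mod (≡mod-refl {a = a}) x≡0) (≡⇒≡mod (ℤP.+-identityʳ a))

  a-x≡a⇒x≡0 : ∀ {a x} → a - x ≡ a mod m → x ≡ 0ℤ mod m
  a-x≡a⇒x≡0 {a} {x} a-x≡a = ≡mod-trans (≡⇒≡mod (lemma a x))
    (≡mod-trans (-‿cong-mod (≡mod-refl {a = a}) a-x≡a) (≡⇒≡mod (ℤP.+-inverseʳ a)))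
    where
    lemma : ∀ a x → x ≡ a - (a - x)
    lemma = solve-∀

≡mod-setoid : ℤ → Setoid 0ℓ 0ℓ
≡mod-setoid m = record { isEquivalence = ≡mod-isEquivalence {m} }

∣⇒≡0 : ∀ {m x} → m Signed.∣ x → x ≡ 0ℤ mod m
∣⇒≡0 {m} {x} = divides-difference ∘ subst (m Signed.∣_) (sym (ℤP.+-identityʳ x))

≡0⇒∣ : ∀ {m x} → x ≡ 0ℤ mod m → m Signed.∣ x
≡0⇒∣ {m} {x} = subst (m Signed.∣_) (ℤP.+-identityʳ x) ∘ m∣a-b

¬2∣⇒odd : ∀ {x} → ¬ (+ 2 ∣ x) → x ≡ + 1 mod + 2
¬2∣⇒odd {x} ¬2∣x with x %ℕ 2 | n%ℕd<d x 2 | a≡a%ℕn+[a/ℕn]*n x 2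
... | 0 | _ | x≡ = ⊥-elim (¬2∣x (∣⇒∣ᵤ (divides (x /ℕ 2) (trans x≡ (ℤP.+-identityˡ _)))))
... | 1 | _ | x≡ = ≡mod-witness (x /ℕ 2) (trans (cong (_- + 1) x≡) (lemma (x /ℕ 2)))
  where
  lemma : ∀ q → (+ 1 + q * + 2) - + 1 ≡ q * + 2
  lemma = solve-∀
... | ℕ.suc (ℕ.suc _) | ℕ.s≤s (ℕ.s≤s ()) | _

odd⇒¬2∣ : ∀ {x} → x ≡ + 1 mod + 2 → ¬ (+ 2 Signed.∣ x)
odd⇒¬2∣ x≡1 2∣x with ℕᵈ.∣⇒≤ (∣⇒∣ᵤ (m∣a-b (≡mod-trans (≡mod-sym (∣⇒≡0 2∣x)) x≡1)))
... | ℕ.s≤s ()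

odd⇒≢neg-mod4 : ∀ {s} → s ≡ + 1 mod + 2 → ¬ (s ≡ - s mod + 4)
odd⇒≢neg-mod4 {s} s≡1 (divides-difference 4∣s+s) =
  odd⇒¬2∣ s≡1 (*-cancelˡ-∣ (+ 2) {+ 2} (subst (+ 4 Signed.∣_) (lemma s) 4∣s+s))
  where
  lemma : ∀ s → s - - s ≡ + 2 * s
  lemma = solve-∀

even⇒double≡0 : ∀ {x} → + 2 ∣ x → + 2 * x ≡ 0ℤ mod + 4
even⇒double≡0 = ∣⇒≡0 ∘ *-monoʳ-∣ (+ 2) {+ 2} ∘ ∣ᵤ⇒∣

double≡0⇒even : ∀ {x} → + 2 * x ≡ 0ℤ mod + 4 → + 2 ∣ x
double≡0⇒even = ∣⇒∣ᵤ ∘ *-cancelˡ-∣ (+ 2) {+ 2} ∘ ≡0⇒∣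

*-odd-mod4 : ∀ {x y} → x ≡ + 1 mod + 2 → y ≡ + 1 mod + 2 → x * y ≡ x + y - + 1 mod + 4
*-odd-mod4 {x} {y} (divides-difference (divides a x-1≡)) (divides-difference (divides b y-1≡)) =
  ≡mod-witness (a * b) (begin
    x * y - (x + y - + 1)  ≡⟨ factor x y ⟩
    (x - + 1) * (y - + 1)  ≡⟨ cong₂ _*_ x-1≡ y-1≡ ⟩
    (a * + 2) * (b * + 2)  ≡⟨ regroup a b ⟩
    (a * b) * + 4          ∎)
  where
  open ≡-Reasoning
  factor : ∀ x y → x * y - (x + y - + 1) ≡ (x - + 1) * (y - + 1)
  factor = solve-∀
  regroup : ∀ a b → (a * + 2) * (b * + 2) ≡ (a * b) * + 4
  regroup = solve-∀

odd*double-mod4 : ∀ {c x} → c ≡ + 1 mod + 2 → c * (+ 2 * x) ≡ + 2 * x mod + 4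
odd*double-mod4 {c} {x} (divides-difference (divides q c-1≡)) =
  ≡mod-witness (q * x) (begin
    c * (+ 2 * x) - + 2 * x  ≡⟨ factor c x ⟩
    (c - + 1) * (+ 2 * x)    ≡⟨ cong (_* (+ 2 * x)) c-1≡ ⟩
    (q * + 2) * (+ 2 * x)    ≡⟨ regroup q x ⟩
    (q * x) * + 4            ∎)
  where
  open ≡-Reasoning
  factor : ∀ c x → c * (+ 2 * x) - + 2 * x ≡ (c - + 1) * (+ 2 * x)
  factor = solve-∀
  regroup : ∀ q x → (q * + 2) * (+ 2 * x) ≡ (q * x) * + 4
  regroup = solve-∀

sumFin-cong : ∀ {n} {f g : Fin n → ℤ} → (∀ k → f k ≡ g k) → sumFin f ≡ sumFin g
sumFin-cong {ℕ.zero}  _   = refl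
sumFin-cong {ℕ.suc n} f≗g = cong₂ _+_ (f≗g zero) (sumFin-cong (f≗g ∘ suc))

sumFin-cong-mod : ∀ {n m} {f g : Fin n → ℤ} → (∀ k → f k ≡ g k mod m) → sumFin f ≡ sumFin g mod m
sumFin-cong-mod {ℕ.zero}  _   = ≡mod-refl
sumFin-cong-mod {ℕ.suc n} f≡g = +-cong-mod (f≡g zero) (sumFin-cong-mod (f≡g ∘ suc))

sumFin-+ : ∀ {n} (f g : Fin n → ℤ) → sumFin (λ k → f k + g k) ≡ sumFin f + sumFin g
sumFin-+ {ℕ.zero}  f g = refl
sumFin-+ {ℕ.suc n} f g = trans (cong (_+_ (f zero + g zero)) (sumFin-+ (f ∘ suc) (g ∘ suc)))
                               (interchange (f zero) (g zero) (sumFin (f ∘ suc)) (sumFin (g ∘ suc)))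

sumFin-neg : ∀ {n} (f : Fin n → ℤ) → sumFin (λ k → - f k) ≡ - sumFin f
sumFin-neg {ℕ.zero}  f = refl
sumFin-neg {ℕ.suc n} f =
  trans (cong (_+_ (- f zero)) (sumFin-neg (f ∘ suc))) (sym (ℤP.neg-distrib-+ (f zero) _))

sumFin-- : ∀ {n} (f g : Fin n → ℤ) → sumFin (λ k → f k - g k) ≡ sumFin f - sumFin g
sumFin-- f g = trans (sumFin-+ f (λ k → - g k)) (cong (_+_ (sumFin f)) (sumFin-neg g))

sumFin-*ˡ : ∀ {n} c (f : Fin n → ℤ) → sumFin (λ k → c * f k) ≡ c * sumFin f
sumFin-*ˡ {ℕ.zero}  c f = sym (ℤP.*-zeroʳ c)
sumFin-*ˡ {ℕ.suc n} c f =
  trans (cong (_+_ (c * f zero)) (sumFin-*ˡ c (f ∘ suc))) (sym (ℤP.*-distribˡ-+ c (f zero) _))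

sumFin-ones : ∀ n → sumFin {n} (λ _ → + 1) ≡ + n
sumFin-ones ℕ.zero    = refl
sumFin-ones (ℕ.suc n) = cong (_+_ (+ 1)) (sumFin-ones n)

+-sumFinℕ : ∀ {n} (g : Fin n → ℕ) → + sumFinℕ g ≡ sumFin (λ k → + g k)
+-sumFinℕ {ℕ.zero}  g = refl
+-sumFinℕ {ℕ.suc n} g = trans (ℤP.pos-+ (g zero) _) (cong (_+_ (+ g zero)) (+-sumFinℕ (g ∘ suc)))

sumFinℕ-cong : ∀ {n} {f g : Fin n → ℕ} → (∀ k → f k ≡ g k) → sumFinℕ f ≡ sumFinℕ g
sumFinℕ-cong {ℕ.zero}  _   = refl
sumFinℕ-cong {ℕ.suc n} f≗g = cong₂ ℕ._+_ (f≗g zero) (sumFinℕ-cong (f≗g ∘ suc))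

I-sym : ∀ {n} (i j : Fin n) → I i j ≡ I j i
I-sym i j with i ≟ j | j ≟ i
... | yes _   | yes _   = refl
... | no  _   | no  _   = refl
... | yes i≡j | no  j≢i = ⊥-elim (j≢i (sym i≡j))
... | no  i≢j | yes j≡i = ⊥-elim (i≢j (sym j≡i))

I-suc : ∀ {n} (i j : Fin n) → I (suc i) (suc j) ≡ I i j
I-suc i j with i ≟ j
... | yes _ = refl
... | no  _ = refl

sumFin-δ : ∀ {n} (i : Fin n) (f : Fin n → ℤ) → sumFin (λ k → I i k * f k) ≡ f i
sumFin-δ {ℕ.suc n} zero f =
  trans (cong₂ _+_ (ℤP.*-identityˡ (f zero)) (sumFin-*ˡ 0ℤ (f ∘ suc))) (ℤP.+-identityʳ (f zero))
sumFin-δ {ℕ.suc n} (suc i) f = trans (ℤP.+-identityˡ _)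
  (trans (sumFin-cong (λ k → cong (_* f (suc k)) (I-suc i k))) (sumFin-δ i (f ∘ suc)))

sumFin-I : ∀ {n} (i : Fin n) → sumFin (I i) ≡ + 1
sumFin-I i = trans (sumFin-cong (λ k → sym (ℤP.*-identityʳ (I i k)))) (sumFin-δ i (λ _ → + 1))

sumFin-odd : ∀ {n} {x : Fin n → ℤ} → (∀ k → x k ≡ + 1 mod + 2) → sumFin x ≡ + n mod + 2
sumFin-odd {n} x-odd = ≡mod-trans (sumFin-cong-mod x-odd) (≡⇒≡mod (sumFin-ones n))

sumFin-*-odd : ∀ {n} {x y : Fin n → ℤ} → (∀ k → x k ≡ + 1 mod + 2) → (∀ k → y k ≡ + 1 mod + 2) →
               sumFin (λ k → x k * y k) ≡ sumFin x + sumFin y - + n mod + 4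
sumFin-*-odd {n} {x} {y} x-odd y-odd =
  ≡mod-trans (sumFin-cong-mod (λ k → *-odd-mod4 (x-odd k) (y-odd k))) (≡⇒≡mod (begin
    sumFin (λ k → x k + y k - + 1)                     ≡⟨ sumFin-- (λ k → x k + y k) (λ _ → + 1) ⟩
    sumFin (λ k → x k + y k) - sumFin {n} (λ _ → + 1)  ≡⟨ cong₂ _-_ (sumFin-+ x y) (sumFin-ones n) ⟩
    sumFin x + sumFin y - + n                          ∎))
  where open ≡-Reasoning

rowSum : ∀ {n} → Mat n → Fin n → ℤ
rowSum A i = sumFin (A i)

colSum : ∀ {n} → Mat n → Fin n → ℤ
colSum A j = sumFin (λ k → A k j)

rowSum-⊖ : ∀ {n} (A B : Mat n) i → rowSum (A ⊖ B) i ≡ rowSum A i - rowSum B i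
rowSum-⊖ A B i = sumFin-- (A i) (B i)

colSum-⊖ : ∀ {n} (A B : Mat n) j → colSum (A ⊖ B) j ≡ colSum A j - colSum B j
colSum-⊖ A B j = sumFin-- (λ k → A k j) (λ k → B k j)

rowSum-·I : ∀ {n} c (i : Fin n) → rowSum (c · I) i ≡ c
rowSum-·I c i = trans (sumFin-*ˡ c (I i)) (trans (cong (c *_) (sumFin-I i)) (ℤP.*-identityʳ c))

colSum-·I : ∀ {n} c (j : Fin n) → colSum (c · I) j ≡ c
colSum-·I c j = trans (sumFin-cong (λ k → cong (c *_) (I-sym k j))) (rowSum-·I c j)

⊗-odd-mod4 : ∀ {n} {A B : Mat n} → (∀ i j → A i j ≡ + 1 mod + 2) → (∀ i j → B i j ≡ + 1 mod + 2) →
             ∀ i j → (A ⊗ B) i j ≡ rowSum A i + colSum B j - + n mod + 4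
⊗-odd-mod4 A-odd B-odd i j = sumFin-*-odd (A-odd i) (λ k → B-odd k j)

⊗-constant-mod : ∀ {n m c} {A B : Mat n} → (∀ i j → A i j ≡ c mod m) →
                 ∀ i j → (A ⊗ B) i j ≡ c * colSum B j mod m
⊗-constant-mod {c = c} {B = B} A≡c i j =
  ≡mod-trans (sumFin-cong-mod (λ k → *-cong-mod (A≡c i k) ≡mod-refl))
             (≡⇒≡mod (sumFin-*ˡ c (λ k → B k j)))

-- Seidel matrices modulo 4

deg : ∀ {n} → Mat n → Fin n → ℤ
deg S i = + degree (Γ S) i

module _ {n} {S : Mat n} (seidel : IsSeidel S) where

  Seidel-entry : ∀ i j → S i j ≡ + 1 - I i j - + 2 * + Γ S i j
  Seidel-entry i j with i ≟ j
  ... | yes refl = proj₁ (proj₂ seidel) i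
  ... | no i≢j with S i j ℤ.≟ - + 1
  ...   | yes Sij≡-1 = Sij≡-1
  ...   | no  Sij≢-1 with proj₂ (proj₂ seidel) i j i≢j
  ...     | inj₁ Sij≡1  = Sij≡1
  ...     | inj₂ Sij≡-1 = ⊥-elim (Sij≢-1 Sij≡-1)

  rowSum-Seidel : ∀ i → rowSum S i ≡ + n - + 1 - + 2 * deg S i
  rowSum-Seidel i = begin
    sumFin (S i)                                                 ≡⟨ sumFin-cong (Seidel-entry i) ⟩
    sumFin (λ k → + 1 - I i k - + 2 * + Γ S i k)                 ≡⟨ sumFin-- _ (λ k → + 2 * + Γ S i k) ⟩
    sumFin (λ k → + 1 - I i k) - sumFin (λ k → + 2 * + Γ S i k)
      ≡⟨ cong₂ _-_ (sumFin-- (λ _ → + 1) (I i)) (sumFin-*ˡ (+ 2) (λ k → + Γ S i k)) ⟩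
    sumFin {n} (λ _ → + 1) - sumFin (I i) - + 2 * sumFin (λ k → + Γ S i k)
      ≡⟨ cong₂ (λ a b → a - + 2 * b) (cong₂ _-_ (sumFin-ones n) (sumFin-I i))
                                     (sym (+-sumFinℕ (Γ S i))) ⟩
    + n - + 1 - + 2 * deg S i                                    ∎
    where open ≡-Reasoning

  colSum-Seidel : ∀ j → colSum S j ≡ rowSum S j
  colSum-Seidel j = sumFin-cong (λ k → proj₁ seidel k j)

  rowSum-Seidel-⊖ : ∀ c i → rowSum (S ⊖ c · I) i ≡ + n - + 1 - + 2 * deg S i - c
  rowSum-Seidel-⊖ c i = trans (rowSum-⊖ S (c · I) i) (cong₂ _-_ (rowSum-Seidel i) (rowSum-·I c i))

  colSum-Seidel-⊖ : ∀ c j → colSum (S ⊖ c · I) j ≡ + n - + 1 - + 2 * deg S j - c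
  colSum-Seidel-⊖ c j = trans (colSum-⊖ S (c · I) j)
    (cong₂ _-_ (trans (colSum-Seidel j) (rowSum-Seidel j)) (colSum-·I c j))

  Seidel-⊖-odd : ∀ {λ'} → λ' ≡ + 1 mod + 2 → ∀ i j → (S ⊖ λ' · I) i j ≡ + 1 mod + 2
  Seidel-⊖-odd λ'≡1 i j =
    ≡mod-trans (-‿cong-mod (≡⇒≡mod (Seidel-entry i j)) (*-cong-mod λ'≡1 ≡mod-refl))
               (≡mod-witness (- (I i j + + Γ S i j)) (lemma (I i j) (+ Γ S i j)))
    where
    lemma : ∀ δ a → (+ 1 - δ - + 2 * a) - + 1 * δ - + 1 ≡ - (δ + a) * + 2
    lemma = solve-∀

  Seidel-quadratic-mod4 : ∀ {λ' μ} → λ' ≡ + 1 mod + 2 → μ ≡ + 1 mod + 2 → ∀ i j →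
    ((S ⊖ λ' · I) ⊗ (S ⊖ μ · I)) i j ≡ (+ n - + 2 - λ' - μ) - (+ 2 * deg S i + + 2 * deg S j) mod + 4
  Seidel-quadratic-mod4 {λ'} {μ} λ'≡1 μ≡1 i j =
    ≡mod-trans (⊗-odd-mod4 (Seidel-⊖-odd λ'≡1) (Seidel-⊖-odd μ≡1) i j) (≡⇒≡mod (trans
      (cong₂ (λ r c → r + c - + n) (rowSum-Seidel-⊖ λ' i) (colSum-Seidel-⊖ μ j))
      (lemma (+ n) λ' μ (deg S i) (deg S j))))
    where
    lemma : ∀ N λ' μ Dᵢ Dⱼ → (N - + 1 - + 2 * Dᵢ - λ') + (N - + 1 - + 2 * Dⱼ - μ) - N ≡
                             (N - + 2 - λ' - μ) - (+ 2 * Dᵢ + + 2 * Dⱼ)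
    lemma = solve-∀

  Seidel-cubic-mod4 : ∀ {M : Mat n} {c} ν → (∀ i j → M i j ≡ c mod + 4) → ∀ i j →
    (M ⊗ (S ⊖ ν · I)) i j ≡ c * (+ n - + 1 - ν) - c * (+ 2 * deg S j) mod + 4
  Seidel-cubic-mod4 {c = c} ν M≡c i j =
    ≡mod-trans (⊗-constant-mod {B = S ⊖ ν · I} M≡c i j)
               (≡⇒≡mod (trans (cong (c *_) (colSum-Seidel-⊖ ν j)) (lemma c (+ n) ν (deg S j))))
    where
    lemma : ∀ c N ν D → c * (N - + 1 - + 2 * D - ν) ≡ c * (N - + 1 - ν) - c * (+ 2 * D)
    lemma = solve-∀

-- Euler graphs and switching

Γ-cong : ∀ {n} {X Y : Mat n} → (∀ i j → X i j ≡ Y i j) → Γ X ≅G Γ Y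
Γ-cong {X = X} {Y} X≗Y i j with i ≟ j
... | yes _ = refl
... | no  _ with X i j ℤ.≟ - + 1 | Y i j ℤ.≟ - + 1
...   | yes _  | yes _  = refl
...   | no  _  | no  _  = refl
...   | yes p  | no ¬q  = ⊥-elim (¬q (trans (sym (X≗Y i j)) p))
...   | no ¬p  | yes q  = ⊥-elim (¬p (trans (X≗Y i j) q))

IsEuler-cong : ∀ {n} {G H : Graph n} → G ≅G H → IsEuler G → IsEuler H
IsEuler-cong G≅H G-euler i = subst (2 ℕᵈ.∣_) (sumFinℕ-cong (G≅H i)) (G-euler i)

Euler⇒double-degree≡0 : ∀ {n} {S : Mat n} → IsEuler (Γ S) → ∀ i → + 2 * deg S i ≡ 0ℤ mod + 4
Euler⇒double-degree≡0 {S = S} euler i = even⇒double≡0 {deg S i} (euler i)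

double-degree≡0⇒Euler : ∀ {n} {S : Mat n} → (∀ i → + 2 * deg S i ≡ 0ℤ mod + 4) → IsEuler (Γ S)
double-degree≡0⇒Euler 2d≡0 i = double≡0⇒even (2d≡0 i)

IsSign : ℤ → Set
IsSign x = (x ≡ + 1) ⊎ (x ≡ - + 1)

IsSign-* : ∀ {x y} → IsSign x → IsSign y → IsSign (x * y)
IsSign-* (inj₁ refl) (inj₁ refl) = inj₁ refl
IsSign-* (inj₁ refl) (inj₂ refl) = inj₂ refl
IsSign-* (inj₂ refl) (inj₁ refl) = inj₂ refl
IsSign-* (inj₂ refl) (inj₂ refl) = inj₁ refl

IsSign-square : ∀ {x} → IsSign x → x * x ≡ + 1
IsSign-square (inj₁ refl) = refl
IsSign-square (inj₂ refl) = refl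

IsSign⇒odd : ∀ {x} → IsSign x → x ≡ + 1 mod + 2
IsSign⇒odd (inj₁ refl) = ≡mod-refl
IsSign⇒odd (inj₂ refl) = ≡mod-witness (- + 1) refl

IsSign-cancel-mod4 : ∀ {a b s} → IsSign a → IsSign b → s ≡ + 1 mod + 2 → a * s ≡ b * s mod + 4 → a ≡ b
IsSign-cancel-mod4 (inj₁ refl) (inj₁ refl) _ _ = refl
IsSign-cancel-mod4 (inj₂ refl) (inj₂ refl) _ _ = refl
IsSign-cancel-mod4 {s = s} (inj₁ refl) (inj₂ refl) s-odd s≡-s = ⊥-elim (odd⇒≢neg-mod4 s-odd
  (≡mod-trans (≡⇒≡mod (sym (ℤP.*-identityˡ s))) (≡mod-trans s≡-s (≡⇒≡mod (ℤP.-1*i≡-i s)))))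
IsSign-cancel-mod4 (inj₂ refl) (inj₁ refl) s-odd -s≡s =
  sym (IsSign-cancel-mod4 (inj₁ refl) (inj₂ refl) s-odd (≡mod-sym -s≡s))

switch-Seidel : ∀ {n} {S : Mat n} {d} → IsSignVec d → IsSeidel S → IsSeidel (switch d S)
switch-Seidel {S = S} {d} sign (symmetric , zero-diagonal , off-diagonal) =
  (λ i j → trans (cong (λ s → d i * s * d j) (symmetric i j)) (swap (d i) (S j i) (d j))) ,
  (λ i → trans (cong (λ s → d i * s * d i) (zero-diagonal i)) (annihilate (d i))) ,
  (λ i j i≢j → IsSign-* (IsSign-* (sign i) (off-diagonal i j i≢j)) (sign j))
  where
  swap : ∀ a s b → a * s * b ≡ b * s * a
  swap = solve-∀
  annihilate : ∀ a → a * + 0 * a ≡ + 0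
  annihilate = solve-∀

rowSum-switch : ∀ {n} (d : Fin n → ℤ) (S : Mat n) i →
                rowSum (switch d S) i ≡ d i * sumFin (λ k → S i k * d k)
rowSum-switch d S i = trans (sumFin-cong (λ k → ℤP.*-assoc (d i) (S i k) (d k)))
                            (sumFin-*ˡ (d i) (λ k → S i k * d k))

switch-constant : ∀ {n} {S : Mat n} {d} → IsSignVec d → (∀ i j → d i ≡ d j) →
                  ∀ i j → switch d S i j ≡ S i j
switch-constant {S = S} {d} sign d-constant i j = begin
  d i * S i j * d j    ≡⟨ cong (d i * S i j *_) (sym (d-constant i j)) ⟩
  d i * S i j * d i    ≡⟨ regroup (d i) (S i j) ⟩
  d i * d i * S i j    ≡⟨ cong (_* S i j) (IsSign-square (sign i)) ⟩
  + 1 * S i j          ≡⟨ ℤP.*-identityˡ (S i j) ⟩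
  S i j                ∎
  where
  open ≡-Reasoning
  regroup : ∀ a s → a * s * a ≡ a * a * s
  regroup = solve-∀

InSwitchingClass-refl : ∀ {n} (S : Mat n) → InSwitchingClass (Γ S) S
InSwitchingClass-refl S = (λ _ → + 1) , (λ _ → inj₁ refl) , Γ-cong (λ i j → sym (ones (S i j)))
  where
  ones : ∀ s → + 1 * s * + 1 ≡ s
  ones = solve-∀

module _ {n} {S : Mat n} (seidel : IsSeidel S) (euler : IsEuler (Γ S))
         {d : Fin n → ℤ} (sign : IsSignVec d) (switched-euler : IsEuler (Γ (switch d S))) where

  -- S ⊖ (-1)·I = S + I has odd entries (unlike S, whose diagonal vanishes), so the
  -- mod-4 product rule applies to it and d.
  sumFin-Seidel*sign-mod4 : ∀ i → sumFin (λ k → S i k * d k) ≡ sumFin d - d i mod + 4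
  sumFin-Seidel*sign-mod4 i = begin
    sumFin (λ k → S i k * d k)                       ≡⟨ sym (a+b-b≡a _ (d i)) ⟩
    sumFin (λ k → S i k * d k) + d i - d i           ≡⟨ cong (_- d i) (sym shifted-sum) ⟩
    sumFin (λ k → S+I i k * d k) - d i               ≈⟨ -‿cong-mod product-rule (≡mod-refl {a = d i}) ⟩
    rowSum S+I i + sumFin d - + n - d i              ≡⟨ cong (λ r → r + sumFin d - + n - d i)
                                                             (rowSum-Seidel-⊖ seidel (- + 1) i) ⟩
    + n - + 1 - + 2 * deg S i - - + 1 + sumFin d - + n - d i
                                                     ≡⟨ lemma (+ n) (deg S i) (sumFin d) (d i) ⟩
    sumFin d - d i - + 2 * deg S i                   ≈⟨ x≡0⇒a-x≡a (Euler⇒double-degree≡0 euler i) ⟩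
    sumFin d - d i                                   ∎
    where
    open import Relation.Binary.Reasoning.Setoid (≡mod-setoid (+ 4))
    S+I = S ⊖ (- + 1) · I
    product-rule : sumFin (λ k → S+I i k * d k) ≡ rowSum S+I i + sumFin d - + n mod + 4
    product-rule = sumFin-*-odd (Seidel-⊖-odd seidel (≡mod-witness (- + 1) refl) i) (IsSign⇒odd ∘ sign)
    shifted-sum : sumFin (λ k → S+I i k * d k) ≡ sumFin (λ k → S i k * d k) + d i
    shifted-sum = trans (sumFin-cong (λ k → expand (S i k) (I i k) (d k)))
      (trans (sumFin-+ (λ k → S i k * d k) (λ k → I i k * d k))
             (cong (_+_ (sumFin (λ k → S i k * d k))) (sumFin-δ i d)))
      where
      expand : ∀ s δ e → (s - - + 1 * δ) * e ≡ s * e + δ * e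
      expand = solve-∀
    a+b-b≡a : ∀ a b → a + b - b ≡ a
    a+b-b≡a = solve-∀
    lemma : ∀ N D s e → N - + 1 - + 2 * D - - + 1 + s - N - e ≡ s - e - + 2 * D
    lemma = solve-∀

  sign*sumFin-mod4 : ∀ i → d i * sumFin d ≡ + n mod + 4
  sign*sumFin-mod4 i = begin
    d i * sumFin d                                ≡⟨ lemma (d i) (sumFin d) ⟩
    d i * (sumFin d - d i) + d i * d i            ≡⟨ cong (_+_ (d i * (sumFin d - d i)))
                                                          (IsSign-square (sign i)) ⟩
    d i * (sumFin d - d i) + + 1                  ≈⟨ +-cong-mod (*-cong-mod (≡mod-refl {a = d i})
                                                                 (≡mod-sym (sumFin-Seidel*sign-mod4 i)))
                                                               (≡mod-refl {a = + 1}) ⟩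
    d i * sumFin (λ k → S i k * d k) + + 1        ≡⟨ cong (_+ + 1) (sym (rowSum-switch d S i)) ⟩
    rowSum (switch d S) i + + 1                   ≡⟨ cong (_+ + 1)
                                                          (rowSum-Seidel (switch-Seidel sign seidel) i) ⟩
    + n - + 1 - + 2 * deg (switch d S) i + + 1    ≈⟨ +-cong-mod (x≡0⇒a-x≡a {a = + n - + 1}
                                                                 (Euler⇒double-degree≡0 switched-euler i))
                                                               (≡mod-refl {a = + 1}) ⟩
    + n - + 1 + + 1                               ≡⟨ lemma′ (+ n) ⟩
    + n                                           ∎
    where
    open import Relation.Binary.Reasoning.Setoid (≡mod-setoid (+ 4))
    lemma : ∀ a s → a * s ≡ a * (s - a) + a * a
    lemma = solve-∀
    lemma′ : ∀ N → N - + 1 + + 1 ≡ N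
    lemma′ = solve-∀

  switching-trivial : + n ≡ + 1 mod + 2 → ∀ i j → switch d S i j ≡ S i j
  switching-trivial n-odd = switch-constant sign λ i j →
    IsSign-cancel-mod4 (sign i) (sign j) (≡mod-trans (sumFin-odd (IsSign⇒odd ∘ sign)) n-odd)
      (≡mod-trans (sign*sumFin-mod4 i) (≡mod-sym (sign*sumFin-mod4 j)))

≡₄-·J⇒ : ∀ {n} {A : Mat n} {c} → A ≡₄ (c · J) → ∀ i j → A i j ≡ c mod + 4
≡₄-·J⇒ {c = c} A≡cJ i j =
  ≡mod-trans (divides-difference (∣ᵤ⇒∣ (A≡cJ i j))) (≡⇒≡mod (ℤP.*-identityʳ c))

≡₄-·J⇐ : ∀ {n} {A : Mat n} {c} → (∀ i j → A i j ≡ c mod + 4) → A ≡₄ (c · J)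
≡₄-·J⇐ {c = c} A≡c i j =
  ∣⇒∣ᵤ (m∣a-b (≡mod-trans (A≡c i j) (≡⇒≡mod (sym (ℤP.*-identityʳ c)))))

lemma8p1 : (n : ℕ) → ¬ (2 ℕᵈ.∣ n) → (S : Mat n) → IsSeidel S →
    (λ' μ ν : ℤ) → ¬ (+ 2 ∣ λ') → ¬ (+ 2 ∣ μ) →
    IsUniqueEulerInClass (Γ S) S ⇔
      (((S ⊖ λ' · I) ⊗ (S ⊖ μ · I)) ≡₄ ((+ n - + 2 - λ' - μ) · J) ×
       ((S ⊖ λ' · I) ⊗ (S ⊖ μ · I) ⊗ (S ⊖ ν · I)) ≡₄ (((+ n - + 2 - λ' - μ) * (+ n - + 1 - ν)) · J))
lemma8p1 n ¬2∣n S seidel λ' μ ν ¬2∣λ' ¬2∣μ = mk⇔ forward backward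
  where
  c  = + n - + 2 - λ' - μ
  c′ = c * (+ n - + 1 - ν)
  M  = (S ⊖ λ' · I) ⊗ (S ⊖ μ · I)
  Z  = S ⊖ ν · I
  2d = λ j → + 2 * deg S j

  n-odd : + n ≡ + 1 mod + 2
  n-odd = ¬2∣⇒odd {+ n} ¬2∣n
  c-odd : c ≡ + 1 mod + 2
  c-odd = ≡mod-trans (-‿cong-mod (-‿cong-mod (-‿cong-mod n-odd (≡mod-refl {a = + 2}))
                                             (¬2∣⇒odd ¬2∣λ')) (¬2∣⇒odd ¬2∣μ))
                     (≡mod-witness (- + 2) refl)
  quadratic : ∀ i j → M i j ≡ c - (2d i + 2d j) mod + 4
  quadratic = Seidel-quadratic-mod4 seidel (¬2∣⇒odd ¬2∣λ') (¬2∣⇒odd ¬2∣μ)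
  cubic : (∀ i j → M i j ≡ c mod + 4) → ∀ i j → (M ⊗ Z) i j ≡ c′ - c * 2d j mod + 4
  cubic = Seidel-cubic-mod4 seidel ν

  forward : IsUniqueEulerInClass (Γ S) S → M ≡₄ (c · J) × (M ⊗ Z) ≡₄ (c′ · J)
  forward (_ , euler , _) = ≡₄-·J⇐ M≡c , ≡₄-·J⇐ MZ≡c′
    where
    2d≡0 = Euler⇒double-degree≡0 euler
    M≡c : ∀ i j → M i j ≡ c mod + 4
    M≡c i j = ≡mod-trans (quadratic i j) (x≡0⇒a-x≡a (+-cong-mod (2d≡0 i) (2d≡0 j)))
    MZ≡c′ : ∀ i j → (M ⊗ Z) i j ≡ c′ mod + 4
    MZ≡c′ i j = ≡mod-trans (cubic M≡c i j)
                           (x≡0⇒a-x≡a (≡mod-trans (odd*double-mod4 {x = deg S j} c-odd) (2d≡0 j)))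

  backward : M ≡₄ (c · J) × (M ⊗ Z) ≡₄ (c′ · J) → IsUniqueEulerInClass (Γ S) S
  backward (M≡cJ , MZ≡c′J) = InSwitchingClass-refl S , euler , λ H (d , sign , H≅) H-euler i j →
    trans (H≅ i j) (Γ-cong (switching-trivial seidel euler sign (IsEuler-cong H≅ H-euler) n-odd) i j)
    where
    MZ≡c′ : ∀ i j → (M ⊗ Z) i j ≡ c′ mod + 4
    MZ≡c′ = ≡₄-·J⇒ MZ≡c′J
    c·2d≡0 : ∀ j → c * 2d j ≡ 0ℤ mod + 4
    c·2d≡0 j = a-x≡a⇒x≡0 (≡mod-trans (≡mod-sym (cubic (≡₄-·J⇒ M≡cJ) j j)) (MZ≡c′ j j))
    euler : IsEuler (Γ S)
    euler = double-degree≡0⇒Euler {S = S} λ j →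
      ≡mod-trans (≡mod-sym (odd*double-mod4 {x = deg S j} c-odd)) (c·2d≡0 j)
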